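{- If $k$ is an integer such that $k>5$, then $\gamma^{SID}(C_{2k+1}(1,4))=k+2$.
   Context: All graphs are simple and undirected. For a graph $G=(V,E)$ and $u\in V$, $N[u]=\{u\}\cup\{v: uv\in E\}$. A code is a nonempty $C\subseteq V$, and $I(C;u)=N[u]\cap C$. $C$ is self-identifying if $I(C;u)\setminus I(C;v)\neq\emptyset$ for all distinct $u,v\in V$. $\gamma^{SID}(G)$ is the minimum cardinality of a self-identifying code in a finite graph $G$. The circulant graph $C_n(1,4)$ has vertex set $\mathbb{Z}_n$, and the open neighbourhood of $u$ is $\{u\pm1,u\pm4\}$ modulo $n$. -}

module Defs where

open import Data.Nat using (ℕ; suc; _+_; _*_; _∸_; _≤_; _%_)
open import Data.Fin using (Fin; toℕ)
open import Data.Fin.Subset using (Subset; _∈_; ∣_∣; Nonempty)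
open import Data.Product using (Σ; ∃; _×_)
open import Data.Sum using (_⊎_)
open import Relation.Nullary using (¬_)
open import Relation.Binary.PropositionalEquality using (_≡_; _≢_)

Graph : ℕ → Set₁
Graph n = Fin n → Fin n → Set

InClosedNbhd : {n : ℕ} → Graph n → Fin n → Fin n → Set
InClosedNbhd G u v = u ≡ v ⊎ G u v

-- The circulant graph C_n(1,4) on Z_n, n = suc m (vertices 0..n-1).
-- u ~ v iff (v - u) mod n ∈ {1, 4, n-1, n-4}, i.e. v = u ± 1 or u ± 4 (mod n).
circDiff : (m : ℕ) → Fin (suc m) → Fin (suc m) → ℕ
circDiff m u v = (toℕ v + (suc m ∸ toℕ u)) % suc m

C14 : (m : ℕ) → Graph (suc m)
C14 m u v = let d = circDiff m u v ; n = suc m in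
  (d ≡ 1 ⊎ d ≡ 4) ⊎ (d ≡ n ∸ 1 ⊎ d ≡ n ∸ 4)

-- C is self-identifying: nonempty, and for all distinct u v,
-- I(C;u) \ I(C;v) ≠ ∅, i.e. some w ∈ C with w ∈ N[u], w ∉ N[v].
SelfIdentifying : {n : ℕ} → Graph n → Subset n → Set
SelfIdentifying {n} G C =
  Nonempty C ×
  ((u v : Fin n) → u ≢ v →
     ∃ λ (w : Fin n) → w ∈ C × InClosedNbhd G u w × ¬ InClosedNbhd G v w)

IsGammaSID : {n : ℕ} → Graph n → ℕ → Set
IsGammaSID {n} G m =
  (∃ λ (C : Subset n) → SelfIdentifying G C × ∣ C ∣ ≡ m) ×
  ((C : Subset n) → SelfIdentifying G C → m ≤ ∣ C ∣)

module Submission where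

open import Defs
open import Algebra.Properties.CommutativeSemigroup using (interchange)
open import Data.Bool using (Bool; true; false; _∨_)
import Data.Bool.Properties as Bool
open import Data.Empty using (⊥)
open import Data.Fin using (Fin; toℕ; fromℕ<)
open import Data.Fin.Properties using (toℕ-injective; toℕ<n; toℕ-fromℕ<; any?; all?) renaming (_≟_ to _≟ᶠ_)
open import Data.Fin.Subset using (Subset; _∈_; ∣_∣; Nonempty)
open import Data.Fin.Subset.Properties using (_∈?_; anySubset?)
open import Data.List using (List; []; _∷_; _++_; map; filter; concatMap; deduplicate)
import Data.List.Membership.DecPropositional as DecMembership
open import Data.List.Membership.Propositional.Properties using (∈-map⁺; ∈-filter⁺; ∈-concatMap⁺; ∈-deduplicate⁺; ∈-++⁺ˡ)
open import Data.List.Relation.Unary.All as All using (All)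
import Data.List.Relation.Unary.Any as Any
open import Data.List.Relation.Unary.Any using (here; there)
open import Data.Nat using (ℕ; zero; suc; _+_; _*_; _∸_; _%_; _/_; _≤_; _<_; _<ᵇ_; _≤?_; _<?_; z≤n; s≤s; s≤s⁻¹)
open import Data.Nat.DivMod using (m%n<n; m<n⇒m%n≡m; n%n≡0; [m+n]%n≡m%n; [m+kn]%n≡m%n; m≡m%n+[m/n]*n; %-distribˡ-+; m%n%n≡m%n)
open import Data.Nat.Properties
open import Data.Nat.Tactic.RingSolver using (solve-∀)
open import Data.Product using (∃; _×_; _,_; proj₁; proj₂)
open import Data.Sum using (_⊎_; inj₁; inj₂)
open import Data.Vec using ([]; _∷_; lookup; tabulate; tail; _∷ʳ_)
open import Data.Vec.Properties using (≡-dec; tabulate-cong; lookup∘tabulate; []=⇒lookup; lookup⇒[]=)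
open import Function using (_∘_)
open import Relation.Binary using (tri<; tri≈; tri>)
open import Relation.Binary.PropositionalEquality
open import Relation.Nullary using (¬_; Dec; yes; no; ¬?; contradiction)
open import Relation.Nullary.Decidable using (_×-dec_; _⊎-dec_; _→-dec_; map′; toWitness; decidable-stable)
open import Relation.Unary using (Decidable)

-- For n ≥ 17 a code is self-identifying iff around every vertex u its trace on
-- N[u] = {u−4, u−1, u, u+1, u+4} separates u from each vertex within distance 8
-- (farther vertices are separated by any code vertex of N[u]).  The code
-- {0, 1, 2, 3} ∪ {odd vertices} of size k + 2 passes this finite test; n = 13, 15
-- are checked exhaustively.
--
-- For the lower bound read C as a bit sequence b.  A potential φ on 5-bit words
-- makes the charge ρ(t) = 2 b(t+4) − 1 + φ(t) − φ(t+1) nonnegative on every valid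
-- 9-bit window, so 2|C| = n + Σρ.  For odd n the total charge is odd, and it
-- cannot be 1: a walk through charge-0 windows that starts after a window of
-- charge 1 never returns to that window's state in 11 or more steps.  Hence
-- 2|C| ≥ n + 3 = 2(k + 2).

-- Finite sums

sumBelow : ℕ → (ℕ → ℕ) → ℕ
sumBelow zero    f = 0
sumBelow (suc n) f = sumBelow n f + f n

sumBelow-cong : ∀ n {f g : ℕ → ℕ} → (∀ i → f i ≡ g i) → sumBelow n f ≡ sumBelow n g
sumBelow-cong zero    f≗g = refl
sumBelow-cong (suc n) f≗g = cong₂ _+_ (sumBelow-cong n f≗g) (f≗g n)

sumBelow-+ : ∀ n (f g : ℕ → ℕ) → sumBelow n (λ i → f i + g i) ≡ sumBelow n f + sumBelow n g
sumBelow-+ zero    f g = refl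
sumBelow-+ (suc n) f g =
  trans (cong (_+ (f n + g n)) (sumBelow-+ n f g)) (interchange +-commutativeSemigroup (sumBelow n f) (sumBelow n g) (f n) (g n))

sumBelow-const : ∀ n c → sumBelow n (λ _ → c) ≡ n * c
sumBelow-const zero    c = refl
sumBelow-const (suc n) c = trans (cong (_+ c) (sumBelow-const n c)) (+-comm (n * c) c)

sumBelow-* : ∀ n c (f : ℕ → ℕ) → sumBelow n (λ i → c * f i) ≡ c * sumBelow n f
sumBelow-* zero    c f = sym (*-zeroʳ c)
sumBelow-* (suc n) c f = trans (cong (_+ c * f n) (sumBelow-* n c f)) (sym (*-distribˡ-+ c (sumBelow n f) (f n)))

sumBelow-suc : ∀ n (f : ℕ → ℕ) → sumBelow (suc n) f ≡ f 0 + sumBelow n (λ i → f (suc i))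
sumBelow-suc zero    f = +-comm 0 (f 0)
sumBelow-suc (suc n) f = trans (cong (_+ f (suc n)) (sumBelow-suc n f)) (+-assoc (f 0) _ (f (suc n)))

sumBelow-shift : ∀ n (f : ℕ → ℕ) → f n ≡ f 0 → sumBelow n (λ i → f (suc i)) ≡ sumBelow n f
sumBelow-shift n f fn≡f0 = +-cancelˡ-≡ (f 0) _ _ (begin
  f 0 + sumBelow n (λ i → f (suc i))   ≡⟨ sumBelow-suc n f ⟨
  sumBelow n f + f n                   ≡⟨ cong (sumBelow n f +_) fn≡f0 ⟩
  sumBelow n f + f 0                   ≡⟨ +-comm (sumBelow n f) (f 0) ⟩
  f 0 + sumBelow n f                   ∎)
  where open ≡-Reasoning

sumBelow-rotate : ∀ n (f : ℕ → ℕ) → (∀ i → f (i + n) ≡ f i) → ∀ s → sumBelow n (λ i → f (i + s)) ≡ sumBelow n f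
sumBelow-rotate n f periodic zero    = sumBelow-cong n (λ i → cong f (+-identityʳ i))
sumBelow-rotate n f periodic (suc s) = begin
  sumBelow n (λ i → f (i + suc s))   ≡⟨ sumBelow-cong n (λ i → cong f (+-suc i s)) ⟩
  sumBelow n (λ i → f (suc i + s))   ≡⟨ sumBelow-shift n (λ i → f (i + s)) (trans (cong f (+-comm n s)) (periodic s)) ⟩
  sumBelow n (λ i → f (i + s))       ≡⟨ sumBelow-rotate n f periodic s ⟩
  sumBelow n f                       ∎
  where open ≡-Reasoning

sumBelow-≡0 : ∀ n (f : ℕ → ℕ) → sumBelow n f ≡ 0 → ∀ i → i < n → f i ≡ 0
sumBelow-≡0 (suc n) f Σ≡0 i i<1+n with m≤n⇒m<n∨m≡n (s≤s⁻¹ i<1+n)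
... | inj₁ i<n  = sumBelow-≡0 n f (m+n≡0⇒m≡0 (sumBelow n f) Σ≡0) i i<n
... | inj₂ refl = m+n≡0⇒n≡0 (sumBelow n f) Σ≡0

sumBelow-nonzero : ∀ n (f : ℕ → ℕ) → sumBelow n f ≢ 0 → ∃ λ i → f i ≢ 0
sumBelow-nonzero zero    f Σ≢0 = contradiction refl Σ≢0
sumBelow-nonzero (suc n) f Σ≢0 with f n ≟ 0
... | no fn≢0  = n , fn≢0
... | yes fn≡0 = sumBelow-nonzero n f (λ Σ≡0 → Σ≢0 (cong₂ _+_ Σ≡0 fn≡0))

sumBelow-single : ∀ n (f : ℕ → ℕ) → (∀ i → f (i + n) ≡ f i) → sumBelow n f ≡ 1 →
                  ∃ λ s → f s ≡ 1 × (∀ i → suc i < n → f (suc i + s) ≡ 0)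
sumBelow-single zero    f periodic ()
sumBelow-single (suc n) f periodic Σ≡1 with sumBelow-nonzero (suc n) f (λ Σ≡0 → 0≢1+n (trans (sym Σ≡0) Σ≡1))
... | s , fs≢0 with split fs≢0 rotated
  where
    rotated : f s + sumBelow n (λ i → f (suc i + s)) ≡ 1
    rotated = trans (sym (sumBelow-suc n (λ i → f (i + s)))) (trans (sumBelow-rotate (suc n) f periodic s) Σ≡1)
    split : ∀ {a b} → a ≢ 0 → a + b ≡ 1 → a ≡ 1 × b ≡ 0
    split {zero}        a≢0 _ = contradiction refl a≢0
    split {suc zero} {zero} _ _ = refl , refl
... | fs≡1 , rest≡0 = s , fs≡1 , λ i i<n → sumBelow-≡0 n (λ i → f (suc i + s)) rest≡0 i (s≤s⁻¹ i<n)

-- The cycle ℤ_n, n = suc m, indexed by ℕ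

vertex : (m : ℕ) → ℕ → Fin (suc m)
vertex m i = fromℕ< (m%n<n i (suc m))

module _ {m : ℕ} where
  private
    n = suc m

  toℕ-vertex : ∀ i → toℕ (vertex m i) ≡ i % n
  toℕ-vertex i = toℕ-fromℕ< (m%n<n i n)

  vertex-cong-% : ∀ i j → i % n ≡ j % n → vertex m i ≡ vertex m j
  vertex-cong-% i j e = toℕ-injective (trans (toℕ-vertex i) (trans e (sym (toℕ-vertex j))))

  vertex-periodic : ∀ i → vertex m (i + n) ≡ vertex m i
  vertex-periodic i = vertex-cong-% (i + n) i ([m+n]%n≡m%n i n)

  vertex-toℕ : ∀ u → vertex m (toℕ u) ≡ u
  vertex-toℕ u = toℕ-injective (trans (toℕ-vertex (toℕ u)) (m<n⇒m%n≡m (toℕ<n u)))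

  [m%n+k]%n≡[m+k]%n : ∀ a b → (a % n + b) % n ≡ (a + b) % n
  [m%n+k]%n≡[m+k]%n a b = begin
      (a % n + b) % n             ≡⟨ %-distribˡ-+ (a % n) b n ⟩
      (a % n % n + b % n) % n     ≡⟨ cong (λ x → (x + b % n) % n) (m%n%n≡m%n a n) ⟩
      (a % n + b % n) % n         ≡⟨ %-distribˡ-+ a b n ⟨
      (a + b) % n                 ∎
    where open ≡-Reasoning

  [k+m%n]%n≡[k+m]%n : ∀ a b → (a + b % n) % n ≡ (a + b) % n
  [k+m%n]%n≡[k+m]%n a b =
    trans (cong (_% n) (+-comm a (b % n))) (trans ([m%n+k]%n≡[m+k]%n b a) (cong (_% n) (+-comm b a)))

  private
    [i+x+[n∸i%n]]%n≡x%n : ∀ i x → (i + x + (n ∸ i % n)) % n ≡ x % n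
    [i+x+[n∸i%n]]%n≡x%n i x = begin
        (i + x + (n ∸ i % n)) % n                  ≡⟨ cong (λ j → (j + x + (n ∸ i % n)) % n) (m≡m%n+[m/n]*n i n) ⟩
        (i % n + i / n * n + x + (n ∸ i % n)) % n  ≡⟨ cong (_% n) (lemma (i % n) (i / n * n) x (n ∸ i % n)) ⟩
        (x + (i % n + (n ∸ i % n)) + i / n * n) % n ≡⟨ cong (λ j → (x + j + i / n * n) % n) (m+[n∸m]≡n (<⇒≤ (m%n<n i n))) ⟩
        (x + n + i / n * n) % n                    ≡⟨ [m+kn]%n≡m%n (x + n) (i / n) n ⟩
        (x + n) % n                                ≡⟨ [m+n]%n≡m%n x n ⟩
        x % n                                      ∎
      where
        open ≡-Reasoning
        lemma : ∀ a b c d → a + b + c + d ≡ c + (a + d) + b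
        lemma = solve-∀

  circDiff-vertex : ∀ i d → circDiff m (vertex m i) (vertex m (i + d)) ≡ d % n
  circDiff-vertex i d = begin
      (toℕ (vertex m (i + d)) + (n ∸ toℕ (vertex m i))) % n  ≡⟨ cong₂ (λ a b → (a + (n ∸ b)) % n) (toℕ-vertex (i + d)) (toℕ-vertex i) ⟩
      ((i + d) % n + (n ∸ i % n)) % n                        ≡⟨ [m%n+k]%n≡[m+k]%n (i + d) (n ∸ i % n) ⟩
      (i + d + (n ∸ i % n)) % n                              ≡⟨ [i+x+[n∸i%n]]%n≡x%n i d ⟩
      d % n                                                  ∎
    where open ≡-Reasoning

  vertex-circDiff : ∀ i w → vertex m (i + circDiff m (vertex m i) w) ≡ w
  vertex-circDiff i w = toℕ-injective (begin
      toℕ (vertex m (i + circDiff m (vertex m i) w))    ≡⟨ toℕ-vertex (i + circDiff m (vertex m i) w) ⟩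
      (i + (toℕ w + (n ∸ toℕ (vertex m i))) % n) % n    ≡⟨ [k+m%n]%n≡[k+m]%n i _ ⟩
      (i + (toℕ w + (n ∸ toℕ (vertex m i)))) % n        ≡⟨ cong (λ r → (i + (toℕ w + (n ∸ r))) % n) (toℕ-vertex i) ⟩
      (i + (toℕ w + (n ∸ i % n))) % n                   ≡⟨ cong (_% n) (+-assoc i (toℕ w) _) ⟨
      (i + toℕ w + (n ∸ i % n)) % n                     ≡⟨ [i+x+[n∸i%n]]%n≡x%n i (toℕ w) ⟩
      toℕ w % n                                         ≡⟨ m<n⇒m%n≡m (toℕ<n w) ⟩
      toℕ w                                             ∎)
    where open ≡-Reasoning

  circDiff-self : ∀ u → circDiff m u u ≡ 0
  circDiff-self u = trans (cong (_% n) (m+[n∸m]≡n (<⇒≤ (toℕ<n u)))) (n%n≡0 n)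

  vertex-+-injective : ∀ {a b} t → a < b → b < a + n → vertex m (a + t) ≢ vertex m (b + t)
  vertex-+-injective {a} t a<b b<a+n eq with m≤n⇒∃[o]m+o≡n a<b
  ... | e , refl = 0≢1+n (begin
      0                                                          ≡⟨ circDiff-self (vertex m (a + t)) ⟨
      circDiff m (vertex m (a + t)) (vertex m (a + t))           ≡⟨ cong (circDiff m (vertex m (a + t))) eq ⟩
      circDiff m (vertex m (a + t)) (vertex m (suc a + e + t))   ≡⟨ cong (circDiff m (vertex m (a + t)) ∘ vertex m) (lemma a e t) ⟩
      circDiff m (vertex m (a + t)) (vertex m (a + t + suc e))   ≡⟨ circDiff-vertex (a + t) (suc e) ⟩
      suc e % n                                                  ≡⟨ m<n⇒m%n≡m (+-cancelˡ-< a (suc e) n (subst (_< a + n) (sym (+-suc a e)) b<a+n)) ⟩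
      suc e                                                      ∎)
    where
      open ≡-Reasoning
      lemma : ∀ a e t → suc a + e + t ≡ a + t + suc e
      lemma = solve-∀

NbhdOffset : ℕ → ℕ → Set
NbhdOffset n d = d ≡ 0 ⊎ ((d ≡ 1 ⊎ d ≡ 4) ⊎ (d ≡ n ∸ 1 ⊎ d ≡ n ∸ 4))

-- q ∈ N[p] in the graph on ℕ with edges i ~ i + 1 and i ~ i + 4, i.e. without wrapping around.
data Near (p q : ℕ) : Set where
  same  : q ≡ p → Near p q
  up1   : q ≡ 1 + p → Near p q
  up4   : q ≡ 4 + p → Near p q
  down1 : p ≡ 1 + q → Near p q
  down4 : p ≡ 4 + q → Near p q

near? : ∀ p q → Dec (Near p q)
near? p q = map′ from to (q ≟ p ⊎-dec (q ≟ 1 + p ⊎-dec (q ≟ 4 + p ⊎-dec (p ≟ 1 + q ⊎-dec p ≟ 4 + q))))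
  where
    from : q ≡ p ⊎ (q ≡ 1 + p ⊎ (q ≡ 4 + p ⊎ (p ≡ 1 + q ⊎ p ≡ 4 + q))) → Near p q
    from (inj₁ e)                      = same e
    from (inj₂ (inj₁ e))               = up1 e
    from (inj₂ (inj₂ (inj₁ e)))        = up4 e
    from (inj₂ (inj₂ (inj₂ (inj₁ e)))) = down1 e
    from (inj₂ (inj₂ (inj₂ (inj₂ e)))) = down4 e
    to : Near p q → q ≡ p ⊎ (q ≡ 1 + p ⊎ (q ≡ 4 + p ⊎ (p ≡ 1 + q ⊎ p ≡ 4 + q)))
    to (same e)  = inj₁ e
    to (up1 e)   = inj₂ (inj₁ e)
    to (up4 e)   = inj₂ (inj₂ (inj₁ e))
    to (down1 e) = inj₂ (inj₂ (inj₂ (inj₁ e)))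
    to (down4 e) = inj₂ (inj₂ (inj₂ (inj₂ e)))

Near⇒≤ : ∀ {p q} → Near p q → p ≤ 4 + q
Near⇒≤ {p} (same refl)      = m≤n+m p 4
Near⇒≤ {p} (up1 refl)       = ≤-trans (n≤1+n p) (+-monoˡ-≤ p (s≤s z≤n))
Near⇒≤ {p} (up4 refl)       = m≤n+m p 8
Near⇒≤ {q = q} (down1 refl) = +-monoˡ-≤ q (s≤s z≤n)
Near⇒≤ (down4 refl)         = ≤-refl

module _ {m : ℕ} where
  private
    n = suc m

  closedNbhd⇒offset : ∀ {u w} → InClosedNbhd (C14 m) u w → NbhdOffset n (circDiff m u w)
  closedNbhd⇒offset {u} (inj₁ refl) = inj₁ (circDiff-self u)
  closedNbhd⇒offset (inj₂ adj)      = inj₂ adj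

  private
    circDiff-at : ∀ i j d → vertex m j ≡ vertex m (i + d) → d < n → circDiff m (vertex m i) (vertex m j) ≡ d
    circDiff-at i j d j≡ d<n = trans (cong (circDiff m (vertex m i)) j≡) (trans (circDiff-vertex i d) (m<n⇒m%n≡m d<n))

    adjacent-offset : ∀ i j d → vertex m j ≡ vertex m (i + d) → d < n →
                      InClosedNbhd (C14 m) (vertex m i) (vertex m j) → NbhdOffset n d
    adjacent-offset i j d j≡ d<n adj = subst (NbhdOffset n) (circDiff-at i j d j≡ d<n) (closedNbhd⇒offset adj)

    offset-adjacent : ∀ i j d → vertex m j ≡ vertex m (i + d) → d < n → (d ≡ 1 ⊎ d ≡ 4) ⊎ (d ≡ n ∸ 1 ⊎ d ≡ n ∸ 4) →
                      InClosedNbhd (C14 m) (vertex m i) (vertex m j)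
    offset-adjacent i j d j≡ d<n off =
      inj₂ (subst (λ x → (x ≡ 1 ⊎ x ≡ 4) ⊎ (x ≡ n ∸ 1 ⊎ x ≡ n ∸ 4)) (sym (circDiff-at i j d j≡ d<n)) off)

    ascending : ∀ p e t → vertex m ((e + p) + t) ≡ vertex m ((p + t) + e)
    ascending p e t = cong (vertex m) (lemma p e t)
      where
        lemma : ∀ p e t → (e + p) + t ≡ (p + t) + e
        lemma = solve-∀

    descending : ∀ q e t → e ≤ n → vertex m (q + t) ≡ vertex m (((e + q) + t) + (n ∸ e))
    descending q e t e≤n = begin
        vertex m (q + t)                      ≡⟨ vertex-periodic (q + t) ⟨
        vertex m ((q + t) + n)                ≡⟨ cong (λ x → vertex m ((q + t) + x)) (m+[n∸m]≡n e≤n) ⟨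
        vertex m ((q + t) + (e + (n ∸ e)))    ≡⟨ cong (vertex m) (lemma q t e (n ∸ e)) ⟩
        vertex m (((e + q) + t) + (n ∸ e))    ∎
      where
        open ≡-Reasoning
        lemma : ∀ q t e d → (q + t) + (e + d) ≡ ((e + q) + t) + d
        lemma = solve-∀

  Near⇒adjacent : 4 ≤ m → ∀ {p q} t → Near p q → InClosedNbhd (C14 m) (vertex m (p + t)) (vertex m (q + t))
  Near⇒adjacent _   t       (same refl)  = inj₁ refl
  Near⇒adjacent 4≤m {p} t   (up1 refl)   = offset-adjacent (p + t) ((1 + p) + t) 1 (ascending p 1 t) (s≤s (≤-trans (s≤s z≤n) 4≤m)) (inj₁ (inj₁ refl))
  Near⇒adjacent 4≤m {p} t   (up4 refl)   = offset-adjacent (p + t) ((4 + p) + t) 4 (ascending p 4 t) (s≤s 4≤m) (inj₁ (inj₂ refl))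
  Near⇒adjacent 4≤m {q = q} t (down1 refl) = offset-adjacent ((1 + q) + t) (q + t) m (descending q 1 t (s≤s z≤n)) ≤-refl (inj₂ (inj₁ refl))
  Near⇒adjacent 4≤m {q = q} t (down4 refl) =
    offset-adjacent ((4 + q) + t) (q + t) (n ∸ 4) (descending q 4 t (s≤s (≤-trans (n≤1+n 3) 4≤m))) (s≤s (m∸n≤m m 3)) (inj₂ (inj₂ refl))

  private
    no-gap : ∀ a b → n ≤ a + b → b ≤ 4 → a + 5 ≤ n → ⊥
    no-gap a b n≤a+b b≤4 a+5≤n = 5≰4 (+-cancelˡ-≤ a 5 4 (begin
        a + 5   ≤⟨ a+5≤n ⟩
        n       ≤⟨ n≤a+b ⟩
        a + b   ≤⟨ +-monoʳ-≤ a b≤4 ⟩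
        a + 4   ∎))
      where
        open ≤-Reasoning
        5≰4 : ¬ 5 ≤ 4
        5≰4 (s≤s (s≤s (s≤s (s≤s ()))))

    not-wrapped : ∀ {e k} → k ≤ 4 → e + 5 ≤ n → e ≢ n ∸ k
    not-wrapped {k = k} k≤4 e+5≤n refl = no-gap (n ∸ k) k (subst (n ≤_) (+-comm k (n ∸ k)) (m≤n+m∸n n k)) k≤4 e+5≤n

    not-short : ∀ {s d} → d ≤ 4 → s + 5 ≤ n → n ∸ s ≢ d
    not-short {s} d≤4 s+5≤n refl = no-gap s (n ∸ s) (m≤n+m∸n n s) d≤4 s+5≤n

    adjacent⇒Near-ascending : ∀ {p q} e t → q ≡ e + p → q + 5 ≤ p + n →
                              InClosedNbhd (C14 m) (vertex m (p + t)) (vertex m (q + t)) → Near p q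
    adjacent⇒Near-ascending {p} e t refl bound adj = classify (adjacent-offset (p + t) ((e + p) + t) e (ascending p e t) e<n adj)
      where
        e+5≤n : e + 5 ≤ n
        e+5≤n = +-cancelˡ-≤ p (e + 5) n (subst (_≤ p + n) (trans (cong (_+ 5) (+-comm e p)) (+-assoc p e 5)) bound)
        e<n : e < n
        e<n = ≤-trans (m≤m+n (suc e) 4) (subst (_≤ n) (+-suc e 4) e+5≤n)
        classify : NbhdOffset n e → Near p (e + p)
        classify (inj₁ refl)               = same refl
        classify (inj₂ (inj₁ (inj₁ refl))) = up1 refl
        classify (inj₂ (inj₁ (inj₂ refl))) = up4 refl
        classify (inj₂ (inj₂ (inj₁ eq)))   = contradiction eq (not-wrapped (s≤s z≤n) e+5≤n)
        classify (inj₂ (inj₂ (inj₂ eq)))   = contradiction eq (not-wrapped ≤-refl e+5≤n)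

    adjacent⇒Near-descending : ∀ {p q} s t → p ≡ s + q → 0 < s → p + 5 ≤ q + n →
                               InClosedNbhd (C14 m) (vertex m (p + t)) (vertex m (q + t)) → Near p q
    adjacent⇒Near-descending {q = q} s t refl 0<s bound adj =
      classify (adjacent-offset ((s + q) + t) (q + t) (n ∸ s) (descending q s t s≤n) (∸-monoʳ-< 0<s s≤n) adj)
      where
        s+5≤n : s + 5 ≤ n
        s+5≤n = +-cancelˡ-≤ q (s + 5) n (subst (_≤ q + n) (trans (cong (_+ 5) (+-comm s q)) (+-assoc q s 5)) bound)
        s≤n : s ≤ n
        s≤n = ≤-trans (m≤m+n s 5) s+5≤n
        classify : NbhdOffset n (n ∸ s) → Near (s + q) q
        classify (inj₁ eq)               = contradiction eq (not-short z≤n s+5≤n)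
        classify (inj₂ (inj₁ (inj₁ eq))) = contradiction eq (not-short (s≤s z≤n) s+5≤n)
        classify (inj₂ (inj₁ (inj₂ eq))) = contradiction eq (not-short ≤-refl s+5≤n)
        classify (inj₂ (inj₂ (inj₁ eq))) = down1 (cong (_+ q) (∸-cancelˡ-≡ s≤n (s≤s z≤n) eq))
        classify (inj₂ (inj₂ (inj₂ eq))) = down4 (cong (_+ q) (∸-cancelˡ-≡ s≤n (≤-trans (n≤1+n 4) (≤-trans (m≤n+m 5 s) s+5≤n)) eq))

  -- The bounds say |p − q| ≤ n − 5, which rules out the wrapping offsets n − 1 and n − 4.
  adjacent⇒Near : ∀ {p q} t → p + 5 ≤ q + n → q + 5 ≤ p + n →
                  InClosedNbhd (C14 m) (vertex m (p + t)) (vertex m (q + t)) → Near p q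
  adjacent⇒Near {p} {q} t p≲q q≲p adj with <-cmp p q
  ... | tri< p<q _ _ = adjacent⇒Near-ascending (q ∸ p) t (sym (m∸n+n≡m (<⇒≤ p<q))) q≲p adj
  ... | tri≈ _ p≡q _ = same (sym p≡q)
  ... | tri> _ _ q<p = adjacent⇒Near-descending (p ∸ q) t (sym (m∸n+n≡m (<⇒≤ q<p))) (m<n⇒0<n∸m q<p) p≲q adj

-- Local description of self-identifying codes

-- Positions p < 17 stand for the vertices p + t around the centre 8 + t, whose
-- closed neighbourhood is at the positions nbhdOffset q.  A pattern π ⊆ Fin 5
-- (the code vertices of that neighbourhood) is valid when it separates the centre
-- from every other position.
nbhdOffset : Fin 5 → ℕ
nbhdOffset = lookup (4 ∷ 7 ∷ 8 ∷ 9 ∷ 12 ∷ [])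

Valid : Subset 5 → Set
Valid π = ∀ {p} → p < 17 → p ≢ 8 → ∃ λ q → q ∈ π × ¬ Near p (nbhdOffset q)

valid? : (π : Subset 5) → Dec (Valid π)
valid? π = allUpTo? (λ p → ¬? (p ≟ 8) →-dec any? λ q → q ∈? π ×-dec ¬? (near? p (nbhdOffset q))) 17

nbhdOffset-range : ∀ q → 4 ≤ nbhdOffset q × nbhdOffset q ≤ 12
nbhdOffset-range = toWitness {a? = all? λ q → 4 ≤? nbhdOffset q ×-dec nbhdOffset q ≤? 12} _

Near-centre : ∀ q → Near 8 (nbhdOffset q)
Near-centre = toWitness {a? = all? λ q → near? 8 (nbhdOffset q)} _

-- The centre of window b t is b (4 + t).
window : (ℕ → Bool) → ℕ → Subset 9
window b t = tabulate λ j → b (toℕ j + t)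

nbhdPattern : Subset 9 → Subset 5
nbhdPattern (a ∷ _ ∷ _ ∷ b ∷ c ∷ d ∷ _ ∷ _ ∷ e ∷ []) = a ∷ b ∷ c ∷ d ∷ e ∷ []

lookup-nbhdPattern : ∀ b t q → lookup (nbhdPattern (window b (4 + t))) q ≡ b (nbhdOffset q + t)
lookup-nbhdPattern b t Fin.zero                                        = refl
lookup-nbhdPattern b t (Fin.suc Fin.zero)                              = refl
lookup-nbhdPattern b t (Fin.suc (Fin.suc Fin.zero))                    = refl
lookup-nbhdPattern b t (Fin.suc (Fin.suc (Fin.suc Fin.zero)))          = refl
lookup-nbhdPattern b t (Fin.suc (Fin.suc (Fin.suc (Fin.suc Fin.zero)))) = refl

module _ {m : ℕ} where
  private
    n = suc m

  codeBits : Subset n → ℕ → Bool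
  codeBits C i = lookup C (vertex m i)

  codeBits-periodic : ∀ C i → codeBits C (i + n) ≡ codeBits C i
  codeBits-periodic C i = cong (lookup C) (vertex-periodic i)

  LocallyValid : Subset n → Set
  LocallyValid C = ∀ t → Valid (nbhdPattern (window (codeBits C) (4 + t)))

  Separates : Subset n → Fin n → Fin n → Set
  Separates C u v = ∃ λ w → w ∈ C × InClosedNbhd (C14 m) u w × ¬ InClosedNbhd (C14 m) v w

  ∈-nbhdPattern : ∀ C t q → vertex m (nbhdOffset q + t) ∈ C → q ∈ nbhdPattern (window (codeBits C) (4 + t))
  ∈-nbhdPattern C t q w∈C = lookup⇒[]= q _ (trans (lookup-nbhdPattern (codeBits C) t q) ([]=⇒lookup w∈C))

  nbhdPattern-∈ : ∀ C t q → q ∈ nbhdPattern (window (codeBits C) (4 + t)) → vertex m (nbhdOffset q + t) ∈ C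
  nbhdPattern-∈ C t q q∈π =
    lookup⇒[]= (vertex m (nbhdOffset q + t)) C (trans (sym (lookup-nbhdPattern (codeBits C) t q)) ([]=⇒lookup q∈π))

  closedNbhd-offsets : 4 ≤ m → ∀ t {w} → InClosedNbhd (C14 m) (vertex m (8 + t)) w →
                       ∃ λ q → w ≡ vertex m (nbhdOffset q + t)
  closedNbhd-offsets 4≤m t {w} adj = offsets (closedNbhd⇒offset adj)
    where
      d = circDiff m (vertex m (8 + t)) w
      w≡ : ∀ {x} → d ≡ x → w ≡ vertex m ((8 + t) + x)
      w≡ refl = sym (vertex-circDiff (8 + t) w)
      offsets : NbhdOffset n d → ∃ λ q → w ≡ vertex m (nbhdOffset q + t)
      offsets (inj₁ eq)               = Fin.suc (Fin.suc Fin.zero) , trans (w≡ eq) (cong (vertex m) (+-identityʳ (8 + t)))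
      offsets (inj₂ (inj₁ (inj₁ eq))) = Fin.suc (Fin.suc (Fin.suc Fin.zero)) , trans (w≡ eq) (cong (vertex m) (+-comm (8 + t) 1))
      offsets (inj₂ (inj₁ (inj₂ eq))) = Fin.suc (Fin.suc (Fin.suc (Fin.suc Fin.zero))) , trans (w≡ eq) (cong (vertex m) (+-comm (8 + t) 4))
      offsets (inj₂ (inj₂ (inj₁ eq))) = Fin.suc Fin.zero , trans (w≡ eq) (trans (cong (vertex m) (lemma t m)) (vertex-periodic (7 + t)))
        where
          lemma : ∀ t m → 8 + t + m ≡ 7 + t + suc m
          lemma = solve-∀
      offsets (inj₂ (inj₂ (inj₂ eq))) = Fin.zero , trans (w≡ eq) (trans (cong (vertex m) wrap) (vertex-periodic (4 + t)))
        where
          lemma : ∀ t x → 8 + t + x ≡ 4 + t + (4 + x)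
          lemma = solve-∀
          wrap : 8 + t + (n ∸ 4) ≡ 4 + t + n
          wrap = trans (lemma t (n ∸ 4)) (cong (4 + t +_) (m+[n∸m]≡n (≤-trans 4≤m (n≤1+n m))))

  private
    centre-distinct : 8 ≤ m → ∀ t {p} → p < 17 → p ≢ 8 → vertex m (8 + t) ≢ vertex m (p + t)
    centre-distinct 8≤m t {p} p<17 p≢8 with <-cmp p 8
    ... | tri< p<8 _ _ = vertex-+-injective t p<8 (≤-trans (s≤s 8≤m) (m≤n+m n p)) ∘ sym
    ... | tri≈ _ p≡8 _ = contradiction p≡8 p≢8
    ... | tri> _ _ 8<p = vertex-+-injective t 8<p (≤-trans p<17 (+-monoʳ-≤ 8 (s≤s 8≤m)))

  selfIdentifying⇒locallyValid : 8 ≤ m → ∀ {C} → SelfIdentifying (C14 m) C → LocallyValid C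
  selfIdentifying⇒locallyValid 8≤m {C} (_ , separates) t {p} p<17 p≢8 =
    pattern-witness (separates (vertex m (8 + t)) (vertex m (p + t)) (centre-distinct 8≤m t p<17 p≢8))
    where
      4≤m = ≤-trans (m≤n+m 4 4) 8≤m
      pattern-witness : Separates C (vertex m (8 + t)) (vertex m (p + t)) →
                        ∃ λ q → q ∈ nbhdPattern (window (codeBits C) (4 + t)) × ¬ Near p (nbhdOffset q)
      pattern-witness (w , w∈C , w∈N[u] , w∉N[v]) with closedNbhd-offsets 4≤m t w∈N[u]
      ... | q , refl = q , ∈-nbhdPattern C t q w∈C , λ near → w∉N[v] (Near⇒adjacent 4≤m t near)

module _ {m : ℕ} (16≤m : 16 ≤ m) {C : Subset (suc m)} (valid : LocallyValid C) where
  private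
    n = suc m
    4≤m : 4 ≤ m
    4≤m = ≤-trans (m≤n+m 4 12) 16≤m

    near-separator : ∀ t {p} → p < 17 → p ≢ 8 → Separates C (vertex m (8 + t)) (vertex m (p + t))
    near-separator t {p} p<17 p≢8 with valid t p<17 p≢8
    ... | q , q∈π , ¬near =
      vertex m (nbhdOffset q + t) , nbhdPattern-∈ C t q q∈π , Near⇒adjacent 4≤m t (Near-centre q) ,
      λ adj → ¬near (adjacent⇒Near t below above adj)
      where
        open ≤-Reasoning
        range = nbhdOffset-range q
        below : p + 5 ≤ nbhdOffset q + n
        below = begin
          p + 5              ≤⟨ +-monoˡ-≤ 5 (s≤s⁻¹ p<17) ⟩
          4 + 17             ≤⟨ +-mono-≤ (proj₁ range) (s≤s 16≤m) ⟩
          nbhdOffset q + n   ∎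
        above : nbhdOffset q + 5 ≤ p + n
        above = begin
          nbhdOffset q + 5   ≤⟨ +-monoˡ-≤ 5 (proj₂ range) ⟩
          17                 ≤⟨ s≤s 16≤m ⟩
          n                  ≤⟨ m≤n+m n p ⟩
          p + n              ∎

    some-member : ∀ t → ∃ λ q → vertex m (nbhdOffset q + t) ∈ C
    some-member t with valid t {0} (s≤s z≤n) (λ ())
    ... | q , q∈π , _ = q , nbhdPattern-∈ C t q q∈π

    far-separator : ∀ t d → 9 ≤ d → d + 9 ≤ n → Separates C (vertex m (8 + t)) (vertex m ((8 + d) + t))
    far-separator t d 9≤d d+9≤n with some-member t
    ... | q , w∈C = vertex m (nbhdOffset q + t) , w∈C , Near⇒adjacent 4≤m t (Near-centre q) ,
                    λ adj → <⇒≱ too-far (Near⇒≤ (adjacent⇒Near t below above adj))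
      where
        open ≤-Reasoning
        range = nbhdOffset-range q
        too-far : 4 + nbhdOffset q < 8 + d
        too-far = begin-strict
          4 + nbhdOffset q   ≤⟨ +-monoʳ-≤ 4 (proj₂ range) ⟩
          16                 <⟨ +-monoʳ-≤ 8 9≤d ⟩
          8 + d              ∎
        below : (8 + d) + 5 ≤ nbhdOffset q + n
        below = begin
          (8 + d) + 5        ≡⟨ lemma d ⟩
          4 + (d + 9)        ≤⟨ +-mono-≤ (proj₁ range) d+9≤n ⟩
          nbhdOffset q + n   ∎
          where
            lemma : ∀ d → (8 + d) + 5 ≡ 4 + (d + 9)
            lemma = solve-∀
        above : nbhdOffset q + 5 ≤ (8 + d) + n
        above = begin
          nbhdOffset q + 5   ≤⟨ +-monoˡ-≤ 5 (proj₂ range) ⟩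
          8 + 9              ≤⟨ +-monoʳ-≤ 8 9≤d ⟩
          8 + d              ≤⟨ m≤m+n (8 + d) n ⟩
          (8 + d) + n        ∎

    reorder : ∀ t d → vertex m ((8 + d) + t) ≡ vertex m ((8 + t) + d)
    reorder t d = cong (vertex m) (lemma t d)
      where
        lemma : ∀ t d → (8 + d) + t ≡ (8 + t) + d
        lemma = solve-∀

    separator-at-distance : ∀ t d → d ≢ 0 → d < n → Separates C (vertex m (8 + t)) (vertex m ((8 + t) + d))
    separator-at-distance t d d≢0 d<n with d ≤? 8
    ... | yes d≤8 = subst (Separates C (vertex m (8 + t))) (reorder t d)
                          (near-separator t (s≤s (+-monoʳ-≤ 8 d≤8)) (d≢0 ∘ +-cancelˡ-≡ 8 d 0))
    ... | no d≰8 with n ≤? d + 8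
    ...   | no d+8<n = subst (Separates C (vertex m (8 + t))) (reorder t d)
                             (far-separator t d (≰⇒> d≰8) (subst (_≤ n) (sym (+-suc d 8)) (≰⇒> d+8<n)))
    ...   | yes n≤d+8 with m≤n⇒∃[o]m+o≡n n≤d+8
    ...     | p , n+p≡ = subst (Separates C (vertex m (8 + t))) (trans (sym (vertex-periodic (p + t))) (cong (vertex m) wrap))
                               (near-separator t p<17 (<⇒≢ p<8))
      where
        p<8 : p < 8
        p<8 = +-cancelˡ-< n p 8 (begin-strict
          n + p     ≡⟨ n+p≡ ⟩
          d + 8     <⟨ +-monoˡ-< 8 d<n ⟩
          n + 8     ∎)
          where open ≤-Reasoning
        p<17 : p < 17
        p<17 = ≤-trans p<8 (m≤m+n 8 9)
        wrap : p + t + n ≡ (8 + t) + d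
        wrap = begin
          p + t + n      ≡⟨ lemma₁ p t n ⟩
          t + (n + p)    ≡⟨ cong (t +_) n+p≡ ⟩
          t + (d + 8)    ≡⟨ lemma₂ t d ⟩
          (8 + t) + d    ∎
          where
            open ≡-Reasoning
            lemma₁ : ∀ p t n → p + t + n ≡ t + (n + p)
            lemma₁ = solve-∀
            lemma₂ : ∀ t d → t + (d + 8) ≡ (8 + t) + d
            lemma₂ = solve-∀

  locallyValid⇒selfIdentifying : SelfIdentifying (C14 m) C
  locallyValid⇒selfIdentifying = nonempty , separates
    where
      nonempty : Nonempty C
      nonempty with some-member 0
      ... | q , w∈C = vertex m (nbhdOffset q + 0) , w∈C

      separates : ∀ u v → u ≢ v → Separates C u v
      separates u v u≢v = subst₂ (Separates C) u≡ v≡ (separator-at-distance t d d≢0 d<n)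
        where
          t = toℕ u + (n ∸ 8)
          u≡ : vertex m (8 + t) ≡ u
          u≡ = begin
            vertex m (8 + (toℕ u + (n ∸ 8)))   ≡⟨ cong (vertex m) (lemma (toℕ u) (n ∸ 8)) ⟩
            vertex m (toℕ u + (8 + (n ∸ 8)))   ≡⟨ cong (λ x → vertex m (toℕ u + x)) (m+[n∸m]≡n (≤-trans (m≤n+m 8 9) (s≤s 16≤m))) ⟩
            vertex m (toℕ u + n)               ≡⟨ vertex-periodic (toℕ u) ⟩
            vertex m (toℕ u)                   ≡⟨ vertex-toℕ u ⟩
            u                                  ∎
            where
              open ≡-Reasoning
              lemma : ∀ a b → 8 + (a + b) ≡ a + (8 + b)
              lemma = solve-∀
          d = circDiff m (vertex m (8 + t)) v
          d<n : d < n
          d<n = m%n<n (toℕ v + (n ∸ toℕ (vertex m (8 + t)))) n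
          v≡ : vertex m ((8 + t) + d) ≡ v
          v≡ = vertex-circDiff (8 + t) v
          d≢0 : d ≢ 0
          d≢0 d≡0 = u≢v (trans (sym u≡) (trans (cong (vertex m) (sym (trans (cong ((8 + t) +_) d≡0) (+-identityʳ (8 + t))))) v≡))

-- Density of locally valid bit sequences

allSubset? : ∀ {n} {P : Subset n → Set} → Decidable P → Dec (∀ s → P s)
allSubset? {P = P} P? with anySubset? {P = λ s → ¬ P s} (λ s → ¬? (P? s))
... | yes (s , ¬Ps) = no λ ∀P → ¬Ps (∀P s)
... | no ∄¬P        = yes λ s → decidable-stable (P? s) (λ ¬Ps → ∄¬P (s , ¬Ps))

bit : Bool → ℕ
bit true  = 1
bit false = 0

∣∣≡sumBelow : ∀ {n} (C : Subset n) (g : ℕ → Bool) → (∀ j → lookup C j ≡ g (toℕ j)) → ∣ C ∣ ≡ sumBelow n (λ i → bit (g i))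
∣∣≡sumBelow []              g C≗g = refl
∣∣≡sumBelow {suc n} (x ∷ C) g C≗g = begin
    ∣ x ∷ C ∣                                       ≡⟨ count-∷ x C ⟩
    bit x + ∣ C ∣                                   ≡⟨ cong₂ _+_ (cong bit (C≗g Fin.zero)) (∣∣≡sumBelow C (λ i → g (suc i)) (C≗g ∘ Fin.suc)) ⟩
    bit (g 0) + sumBelow n (λ i → bit (g (suc i)))  ≡⟨ sumBelow-suc n (λ i → bit (g i)) ⟨
    sumBelow (suc n) (λ i → bit (g i))              ∎
  where
    open ≡-Reasoning
    count-∷ : ∀ {n} x (C : Subset n) → ∣ x ∷ C ∣ ≡ bit x + ∣ C ∣
    count-∷ true  C = refl
    count-∷ false C = refl

-- A shortest-path potential for the weights 2 (centre w) − 1 of the valid windows w,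
-- found by computer; only `discharging` and `noReturn` depend on its values.
potential : Subset 5 → ℕ
potential (false ∷ false ∷ false ∷ false ∷ false ∷ []) = 0
potential (false ∷ false ∷ false ∷ false ∷ true ∷ []) = 0
potential (false ∷ false ∷ false ∷ true ∷ false ∷ []) = 2
potential (false ∷ false ∷ false ∷ true ∷ true ∷ []) = 1
potential (false ∷ false ∷ true ∷ false ∷ false ∷ []) = 2
potential (false ∷ false ∷ true ∷ false ∷ true ∷ []) = 1
potential (false ∷ false ∷ true ∷ true ∷ false ∷ []) = 2
potential (false ∷ false ∷ true ∷ true ∷ true ∷ []) = 2
potential (false ∷ true ∷ false ∷ false ∷ false ∷ []) = 1
potential (false ∷ true ∷ false ∷ false ∷ true ∷ []) = 1
potential (false ∷ true ∷ false ∷ true ∷ false ∷ []) = 3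
potential (false ∷ true ∷ false ∷ true ∷ true ∷ []) = 2
potential (false ∷ true ∷ true ∷ false ∷ false ∷ []) = 2
potential (false ∷ true ∷ true ∷ false ∷ true ∷ []) = 1
potential (false ∷ true ∷ true ∷ true ∷ false ∷ []) = 3
potential (false ∷ true ∷ true ∷ true ∷ true ∷ []) = 3
potential (true ∷ false ∷ false ∷ false ∷ false ∷ []) = 1
potential (true ∷ false ∷ false ∷ false ∷ true ∷ []) = 1
potential (true ∷ false ∷ false ∷ true ∷ false ∷ []) = 3
potential (true ∷ false ∷ false ∷ true ∷ true ∷ []) = 2
potential (true ∷ false ∷ true ∷ false ∷ false ∷ []) = 2
potential (true ∷ false ∷ true ∷ false ∷ true ∷ []) = 2
potential (true ∷ false ∷ true ∷ true ∷ false ∷ []) = 3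
potential (true ∷ false ∷ true ∷ true ∷ true ∷ []) = 3
potential (true ∷ true ∷ false ∷ false ∷ false ∷ []) = 2
potential (true ∷ true ∷ false ∷ false ∷ true ∷ []) = 2
potential (true ∷ true ∷ false ∷ true ∷ false ∷ []) = 3
potential (true ∷ true ∷ false ∷ true ∷ true ∷ []) = 2
potential (true ∷ true ∷ true ∷ false ∷ false ∷ []) = 3
potential (true ∷ true ∷ true ∷ false ∷ true ∷ []) = 2
potential (true ∷ true ∷ true ∷ true ∷ false ∷ []) = 4
potential (true ∷ true ∷ true ∷ true ∷ true ∷ []) = 4

head5 : Subset 9 → Subset 5
head5 (a ∷ b ∷ c ∷ d ∷ e ∷ _) = a ∷ b ∷ c ∷ d ∷ e ∷ []

next5 : Subset 9 → Subset 5
next5 (_ ∷ a ∷ b ∷ c ∷ d ∷ e ∷ _) = a ∷ b ∷ c ∷ d ∷ e ∷ []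

centre : Subset 9 → Bool
centre (_ ∷ _ ∷ _ ∷ _ ∷ c ∷ _) = c

-- Truncated subtraction; by `discharging` it is exact on valid windows.
charge : Subset 9 → ℕ
charge w = (2 * bit (centre w) + potential (head5 w)) ∸ (1 + potential (next5 w))

discharging : ∀ w → Valid (nbhdPattern w) → 1 + potential (next5 w) ≤ 2 * bit (centre w) + potential (head5 w)
discharging = toWitness {a? = allSubset? λ w → valid? (nbhdPattern w) →-dec (_ ≤? _)} _

-- A window w is an edge from source w to tail w in the de Bruijn graph on 8-bit states.
State : Set
State = Subset 8

source : Subset 9 → State
source (a ∷ b ∷ c ∷ d ∷ e ∷ f ∷ g ∷ h ∷ _ ∷ []) = a ∷ b ∷ c ∷ d ∷ e ∷ f ∷ g ∷ h ∷ []

Quiet : Subset 9 → Set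
Quiet w = Valid (nbhdPattern w) × charge w ≡ 0

quiet? : ∀ w → Dec (Quiet w)
quiet? w = valid? (nbhdPattern w) ×-dec (charge w ≟ 0)

extensions : State → List (Subset 9)
extensions x = (x ∷ʳ false) ∷ (x ∷ʳ true) ∷ []

successors : State → List State
successors x = map tail (filter quiet? (extensions x))

_≟ₛ_ : (x y : State) → Dec (x ≡ y)
_≟ₛ_ = ≡-dec Bool._≟_

open DecMembership _≟ₛ_ using () renaming (_∈_ to _∈ₗ_; _∉_ to _∉ₗ_; _∈?_ to _∈ₗ?_)

step : List State → List State
step xs = deduplicate _≟ₛ_ (concatMap successors xs)

reach : ℕ → State → List State
reach zero    x = x ∷ []
reach (suc i) x = step (reach i x)

-- Once Closed (as checked in noReturn), this holds every state reachable from y in 11 or more quiet steps.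
eventually : State → List State
eventually y = reach 11 y ++ reach 12 y

Closed : List State → Set
Closed Q = All (λ x → All (_∈ₗ Q) (successors x)) Q

closed? : ∀ Q → Dec (Closed Q)
closed? Q = All.all? (λ x → All.all? (_∈ₗ? Q) (successors x)) Q

noReturn : ∀ w → Valid (nbhdPattern w) → charge w ≡ 1 → Closed (eventually (tail w)) × source w ∉ₗ eventually (tail w)
noReturn = toWitness {a? = allSubset? λ w → valid? (nbhdPattern w) →-dec
                         (charge w ≟ 1 →-dec (closed? (eventually (tail w)) ×-dec ¬? (source w ∈ₗ? eventually (tail w))))} _

module Density {n : ℕ} (b : ℕ → Bool) (periodic : ∀ i → b (i + n) ≡ b i)
               (valid : ∀ t → Valid (nbhdPattern (window b t))) where

  S : ℕ
  S = sumBelow n (λ i → bit (b i))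

  ρ : ℕ → ℕ
  ρ t = charge (window b t)

  φ : ℕ → ℕ
  φ t = potential (head5 (window b t))

  state : ℕ → State
  state t = source (window b t)

  window-periodic : ∀ t → window b (t + n) ≡ window b t
  window-periodic t = tabulate-cong λ j → trans (cong b (sym (+-assoc (toℕ j) t n))) (periodic (toℕ j + t))

  ρ-periodic : ∀ t → ρ (t + n) ≡ ρ t
  ρ-periodic t = cong charge (window-periodic t)

  discharge : ∀ t → 2 * bit (b (4 + t)) + φ t ≡ ρ t + (1 + φ (suc t))
  discharge t = sym (m∸n+n≡m (discharging (window b t) (valid t)))

  charge-balance : 2 * S ≡ sumBelow n ρ + n
  charge-balance = +-cancelʳ-≡ P _ _ (begin
      2 * S + P                                                  ≡⟨ cong (λ x → 2 * x + P) (sumBelow-rotate n (λ i → bit (b i)) (cong bit ∘ periodic) 4) ⟨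
      2 * sumBelow n (λ t → bit (b (t + 4))) + P                ≡⟨ cong (λ x → 2 * x + P) (sumBelow-cong n (λ t → cong (bit ∘ b) (+-comm t 4))) ⟩
      2 * sumBelow n (λ t → bit (b (4 + t))) + P                ≡⟨ cong (_+ P) (sumBelow-* n 2 (λ t → bit (b (4 + t)))) ⟨
      sumBelow n (λ t → 2 * bit (b (4 + t))) + P                ≡⟨ sumBelow-+ n (λ t → 2 * bit (b (4 + t))) φ ⟨
      sumBelow n (λ t → 2 * bit (b (4 + t)) + φ t)              ≡⟨ sumBelow-cong n discharge ⟩
      sumBelow n (λ t → ρ t + (1 + φ (suc t)))                  ≡⟨ sumBelow-+ n ρ (λ t → 1 + φ (suc t)) ⟩
      R + sumBelow n (λ t → 1 + φ (suc t))                      ≡⟨ cong (R +_) (sumBelow-+ n (λ _ → 1) (λ t → φ (suc t))) ⟩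
      R + (sumBelow n (λ _ → 1) + sumBelow n (λ t → φ (suc t))) ≡⟨ cong₂ (λ x y → R + (x + y)) ones shifted ⟩
      R + (n + P)                                                ≡⟨ +-assoc R n P ⟨
      R + n + P                                                  ∎)
    where
      open ≡-Reasoning
      P = sumBelow n φ
      R = sumBelow n ρ
      ones : sumBelow n (λ _ → 1) ≡ n
      ones = trans (sumBelow-const n 1) (*-identityʳ n)
      shifted : sumBelow n (λ t → φ (suc t)) ≡ P
      shifted = sumBelow-shift n φ (cong (potential ∘ head5) (window-periodic 0))

  private
    successor : ∀ x c → Quiet (x ∷ʳ c) → tail (x ∷ʳ c) ∈ₗ successors x
    successor x false q = ∈-map⁺ tail (∈-filter⁺ quiet? {xs = extensions x} (here refl) q)
    successor x true  q = ∈-map⁺ tail (∈-filter⁺ quiet? {xs = extensions x} (there (here refl)) q)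

    ∈-step : ∀ {x y xs} → x ∈ₗ xs → y ∈ₗ successors x → y ∈ₗ step xs
    ∈-step x∈xs y∈ = ∈-deduplicate⁺ _≟ₛ_ (∈-concatMap⁺ successors (Any.map (λ x≡ → subst (λ z → _ ∈ₗ successors z) x≡ y∈) x∈xs))

  QuietFrom : ℕ → ℕ → Set
  QuietFrom s L = ∀ i → i < L → Quiet (window b (i + s))

  reach-walk : ∀ L s → QuietFrom s L → state (L + s) ∈ₗ reach L (state s)
  reach-walk zero    s quiet = here refl
  reach-walk (suc L) s quiet =
    ∈-step (reach-walk L s (λ i i<L → quiet i (m<n⇒m<1+n i<L))) (successor (state (L + s)) (b (8 + (L + s))) (quiet L ≤-refl))

  closed-walk : ∀ {Q} → Closed Q → ∀ L s → state s ∈ₗ Q → QuietFrom s L → state (L + s) ∈ₗ Q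
  closed-walk closed zero    s x∈Q quiet = x∈Q
  closed-walk closed (suc L) s x∈Q quiet =
    All.lookup (All.lookup closed (closed-walk closed L s x∈Q (λ i i<L → quiet i (m<n⇒m<1+n i<L))))
               (successor (state (L + s)) (b (8 + (L + s))) (quiet L ≤-refl))

  no-single-charge : 12 ≤ n → sumBelow n ρ ≢ 1
  no-single-charge 12≤n Σ≡1 with sumBelow-single n ρ ρ-periodic Σ≡1
  ... | s , ρs≡1 , rest = proj₂ certificate (subst (_∈ₗ eventually (state (suc s))) returns late)
    where
      certificate = noReturn (window b s) (valid s) ρs≡1
      quiet : ∀ i → suc i < n → Quiet (window b (i + suc s))
      quiet i i<n = subst Quiet (cong (window b) (sym (+-suc i s))) (valid (suc i + s) , rest i i<n)
      early : state (11 + suc s) ∈ₗ eventually (state (suc s))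
      early = ∈-++⁺ˡ (reach-walk 11 (suc s) λ i i<11 → quiet i (≤-trans (s≤s i<11) 12≤n))
      late : state ((n ∸ 12) + (11 + suc s)) ∈ₗ eventually (state (suc s))
      late = closed-walk (proj₁ certificate) (n ∸ 12) (11 + suc s) early λ i i<n∸12 →
        subst Quiet (cong (window b) (+-assoc i 11 (suc s)))
              (quiet (i + 11) (subst₂ _<_ (+-suc i 11) (m∸n+n≡m 12≤n) (+-monoˡ-< 12 i<n∸12)))
      returns : state ((n ∸ 12) + (11 + suc s)) ≡ state s
      returns = cong source (trans (cong (window b) index) (window-periodic s))
        where
          index : (n ∸ 12) + (11 + suc s) ≡ s + n
          index = begin
            (n ∸ 12) + (11 + suc s)   ≡⟨ cong ((n ∸ 12) +_) (+-comm 12 s) ⟩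
            (n ∸ 12) + (s + 12)       ≡⟨ x+[y+z]≡y+[x+z] (n ∸ 12) s 12 ⟩
            s + ((n ∸ 12) + 12)       ≡⟨ cong (s +_) (m∸n+n≡m 12≤n) ⟩
            s + n                     ∎
            where
              open ≡-Reasoning
              x+[y+z]≡y+[x+z] : ∀ x y z → x + (y + z) ≡ y + (x + z)
              x+[y+z]≡y+[x+z] = solve-∀

  density : ∀ k → n ≡ suc (2 * k) → 12 ≤ n → k + 2 ≤ S
  density k n≡ 12≤n = odd-total (sumBelow n ρ) charge-balance (no-single-charge 12≤n)
    where
      odd-total : ∀ R → 2 * S ≡ R + n → R ≢ 1 → k + 2 ≤ S
      odd-total 0 balance _ = contradiction (trans balance n≡) (even≢odd S k)
      odd-total 1 _ R≢1 = contradiction refl R≢1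
      odd-total 2 balance _ = contradiction (trans balance (trans (cong (2 +_) n≡) (cong suc (lemma k)))) (even≢odd S (suc k))
        where
          lemma : ∀ k → suc (suc (2 * k)) ≡ 2 * suc k
          lemma = solve-∀
      odd-total (suc (suc (suc x))) balance _ = *-cancelˡ-≤ 2 (begin
          2 * (k + 2)           ≡⟨ lemma k ⟩
          4 + 2 * k             ≤⟨ m≤n+m (4 + 2 * k) x ⟩
          x + (4 + 2 * k)       ≡⟨ lemma′ x k ⟩
          3 + x + suc (2 * k)   ≡⟨ cong (3 + x +_) n≡ ⟨
          3 + x + n             ≡⟨ balance ⟨
          2 * S                 ∎)
        where
          open ≤-Reasoning
          lemma : ∀ k → 2 * (k + 2) ≡ 4 + 2 * k
          lemma = solve-∀
          lemma′ : ∀ x k → x + (4 + 2 * k) ≡ 3 + x + suc (2 * k)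
          lemma′ = solve-∀

-- A self-identifying code of size k + 2

odd : ℕ → Bool
odd zero          = false
odd (suc zero)    = true
odd (suc (suc i)) = odd i

inCode : ℕ → Bool
inCode i = (i <ᵇ 4) ∨ odd i

code : (n : ℕ) → Subset n
code n = tabulate λ i → inCode (toℕ i)

alternation : ∀ i → bit (odd i) + bit (odd (suc i)) ≡ 1
alternation zero          = refl
alternation (suc zero)    = refl
alternation (suc (suc i)) = alternation i

code-count : ∀ j → sumBelow (5 + (j + j)) (λ i → bit (inCode i)) ≡ 4 + j
code-count zero    = refl
code-count (suc j) = begin
    sumBelow (5 + (suc j + suc j)) f                                 ≡⟨ cong (λ x → sumBelow (6 + x) f) (+-suc j j) ⟩
    sumBelow (7 + (j + j)) f                                         ≡⟨⟩
    sumBelow (5 + (j + j)) f + f (5 + (j + j)) + f (6 + (j + j))     ≡⟨ +-assoc (sumBelow (5 + (j + j)) f) _ _ ⟩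
    sumBelow (5 + (j + j)) f + (f (5 + (j + j)) + f (6 + (j + j)))   ≡⟨ cong₂ _+_ (code-count j) (alternation (5 + (j + j))) ⟩
    4 + j + 1                                                        ≡⟨ +-comm (4 + j) 1 ⟩
    4 + suc j                                                        ∎
  where
    open ≡-Reasoning
    f = λ i → bit (inCode i)

∣code∣ : ∀ k → 2 ≤ k → ∣ code (suc (2 * k)) ∣ ≡ k + 2
∣code∣ (suc (suc j)) _ = begin
    ∣ code (suc (2 * suc (suc j))) ∣                          ≡⟨ ∣∣≡sumBelow (code (suc (2 * suc (suc j)))) inCode (lookup∘tabulate (inCode ∘ toℕ)) ⟩
    sumBelow (suc (2 * suc (suc j))) (λ i → bit (inCode i))  ≡⟨ cong (λ x → sumBelow x (λ i → bit (inCode i))) (lemma j) ⟩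
    sumBelow (5 + (j + j)) (λ i → bit (inCode i))            ≡⟨ code-count j ⟩
    4 + j                                                    ≡⟨ +-comm 2 (suc (suc j)) ⟩
    suc (suc j) + 2                                          ∎
  where
    open ≡-Reasoning
    lemma : ∀ j → suc (2 * suc (suc j)) ≡ 5 + (j + j)
    lemma = solve-∀
∣code∣ (suc zero) (s≤s ())

window-cong : ∀ (b b′ : ℕ → Bool) s s′ → (∀ j → j < 9 → b (j + s) ≡ b′ (j + s′)) → window b s ≡ window b′ s′
window-cong b b′ s s′ eq = tabulate-cong λ j → eq (toℕ j) (toℕ<n j)

inCode-≥4 : ∀ {i} → 4 ≤ i → inCode i ≡ odd i
inCode-≥4 (s≤s (s≤s (s≤s (s≤s _)))) = refl

odd-+-double : ∀ i a → odd (i + (a + a)) ≡ odd i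
odd-+-double i zero    = cong odd (+-identityʳ i)
odd-+-double i (suc a) = trans (cong odd (lemma i a)) (odd-+-double i a)
  where
    lemma : ∀ i a → i + (suc a + suc a) ≡ suc (suc (i + (a + a)))
    lemma = solve-∀

codeBits-code : ∀ {m} i → i < suc m → codeBits (code (suc m)) i ≡ inCode i
codeBits-code {m} i i<n = trans (lookup∘tabulate (inCode ∘ toℕ) (vertex m i)) (cong inCode (trans (toℕ-vertex i) (m<n⇒m%n≡m i<n)))

alternating-valid : ∀ r → Valid (nbhdPattern (window odd (4 + r)))
alternating-valid zero          = toWitness {a? = valid? (nbhdPattern (window odd 4))} _
alternating-valid (suc zero)    = toWitness {a? = valid? (nbhdPattern (window odd 5))} _
alternating-valid (suc (suc r)) = alternating-valid r

-- The code of length 17 + 2a seen from just before its seam at vertex 0; up to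
-- 20 bits ahead this does not depend on a.
seam : ℕ → ℕ → Bool
seam a x = codeBits (code (17 + (a + a))) (9 + (a + a) + x)

seam-low : ∀ a x → x < 8 → seam a x ≡ odd (9 + x)
seam-low a x x<8 = begin
    codeBits (code (17 + (a + a))) (9 + (a + a) + x) ≡⟨ codeBits-code (9 + (a + a) + x) bound ⟩
    inCode (9 + (a + a) + x)                        ≡⟨ inCode-≥4 (≤-trans (m≤m+n 4 5) (m≤m+n 9 ((a + a) + x))) ⟩
    odd (9 + (a + a) + x)                           ≡⟨ cong odd (lemma a x) ⟩
    odd ((9 + x) + (a + a))                         ≡⟨ odd-+-double (9 + x) a ⟩
    odd (9 + x)                                     ∎
  where
    open ≡-Reasoning
    lemma : ∀ a x → 9 + (a + a) + x ≡ (9 + x) + (a + a)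
    lemma = solve-∀
    bound : 9 + (a + a) + x < 17 + (a + a)
    bound = subst (_< 17 + (a + a)) (sym (lemma a x)) (+-monoˡ-< (a + a) (+-monoʳ-≤ 9 x<8))

seam-high : ∀ a y → y < 17 → seam a (8 + y) ≡ inCode y
seam-high a y y<17 = begin
    codeBits (code n) (9 + (a + a) + (8 + y))   ≡⟨ cong (codeBits (code n)) (lemma a y) ⟩
    codeBits (code n) (y + n)                   ≡⟨ codeBits-periodic (code n) y ⟩
    codeBits (code n) y                         ≡⟨ codeBits-code y (≤-trans y<17 (m≤m+n 17 (a + a))) ⟩
    inCode y                                    ∎
  where
    open ≡-Reasoning
    n = 17 + (a + a)
    lemma : ∀ a y → 9 + (a + a) + (8 + y) ≡ y + (17 + (a + a))
    lemma = solve-∀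

seam-independent : ∀ a x → x < 20 → seam a x ≡ seam 0 x
seam-independent a x x<20 with x <? 8
... | yes x<8 = trans (seam-low a x x<8) (sym (seam-low 0 x x<8))
... | no x≮8 with m≤n⇒∃[o]m+o≡n (≮⇒≥ x≮8)
...   | y , refl = trans (seam-high a y y<17) (sym (seam-high 0 y y<17))
  where
    y<17 : y < 17
    y<17 = ≤-trans (+-cancelˡ-< 8 y 12 x<20) (m≤m+n 12 5)

seam-valid : ∀ {s} → s < 12 → Valid (nbhdPattern (window (seam 0) s))
seam-valid = toWitness {a? = allUpTo? (λ s → valid? (nbhdPattern (window (seam 0) s))) 12} _

code-locallyValid : ∀ a → LocallyValid (code (17 + (a + a)))
code-locallyValid a t = subst (Valid ∘ nbhdPattern) (sym reduce) (at (t % n) (m%n<n t n))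
  where
    n = 17 + (a + a)
    b = codeBits (code n)
    reduce : window b (4 + t) ≡ window b (4 + t % n)
    reduce = window-cong b b (4 + t) (4 + t % n) λ j _ →
      cong (lookup (code n)) (vertex-cong-% (j + (4 + t)) (j + (4 + t % n)) (begin
        (j + (4 + t)) % n        ≡⟨ cong (_% n) (+-assoc j 4 t) ⟨
        (j + 4 + t) % n          ≡⟨ [k+m%n]%n≡[k+m]%n {16 + (a + a)} (j + 4) t ⟨
        (j + 4 + t % n) % n      ≡⟨ cong (_% n) (+-assoc j 4 (t % n)) ⟩
        (j + (4 + t % n)) % n    ∎))
      where open ≡-Reasoning
    at : ∀ r → r < n → Valid (nbhdPattern (window b (4 + r)))
    at r r<n with r <? 5 + (a + a)
    ... | yes interior = subst (Valid ∘ nbhdPattern) (sym alternating) (alternating-valid r)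
      where
        alternating : window b (4 + r) ≡ window odd (4 + r)
        alternating = window-cong b odd (4 + r) (4 + r) λ j j<9 →
          trans (codeBits-code (j + (4 + r)) (s≤s (+-mono-≤ (s≤s⁻¹ j<9) (+-monoʳ-≤ 4 (s≤s⁻¹ interior)))))
                (inCode-≥4 (≤-trans (m≤m+n 4 r) (m≤n+m (4 + r) j)))
    ... | no r≮ with m≤n⇒∃[o]m+o≡n (≮⇒≥ r≮)
    ...   | s , refl = subst (Valid ∘ nbhdPattern) (sym (trans to-seam from-seam)) (seam-valid s<12)
      where
        s<12 : s < 12
        s<12 = +-cancelˡ-< (5 + (a + a)) s 12 (subst (5 + (a + a) + s <_) (lemma a) r<n)
          where
            lemma : ∀ a → 17 + (a + a) ≡ 5 + (a + a) + 12
            lemma = solve-∀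
        to-seam : window b (4 + (5 + (a + a) + s)) ≡ window (seam a) s
        to-seam = window-cong b (seam a) (4 + (5 + (a + a) + s)) s λ j _ → cong b (lemma j a s)
          where
            lemma : ∀ j a s → j + (4 + (5 + (a + a) + s)) ≡ 9 + (a + a) + (j + s)
            lemma = solve-∀
        from-seam : window (seam a) s ≡ window (seam 0) s
        from-seam = window-cong (seam a) (seam 0) s s λ j j<9 → seam-independent a (j + s) (s≤s (+-mono-≤ (s≤s⁻¹ j<9) (s≤s⁻¹ s<12)))

closedNbhd? : ∀ {m} (u w : Fin (suc m)) → Dec (InClosedNbhd (C14 m) u w)
closedNbhd? {m} u w = u ≟ᶠ w ⊎-dec ((d ≟ 1 ⊎-dec d ≟ 4) ⊎-dec (d ≟ suc m ∸ 1 ⊎-dec d ≟ suc m ∸ 4))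
  where d = circDiff m u w

selfIdentifying? : ∀ m (C : Subset (suc m)) → Dec (SelfIdentifying (C14 m) C)
selfIdentifying? m C = any? (_∈? C) ×-dec all? λ u → all? λ v → ¬? (u ≟ᶠ v) →-dec
  any? λ w → w ∈? C ×-dec (closedNbhd? u w ×-dec ¬? (closedNbhd? v w))

-- Below length 17 the local criterion does not apply; lengths 13 and 15 are checked exhaustively.
code-selfIdentifying : ∀ k → 5 < k → SelfIdentifying (C14 (2 * k)) (code (suc (2 * k)))
code-selfIdentifying 6 _ = toWitness {a? = selfIdentifying? 12 (code 13)} _
code-selfIdentifying 7 _ = toWitness {a? = selfIdentifying? 14 (code 15)} _
code-selfIdentifying (suc (suc (suc (suc (suc (suc (suc (suc a)))))))) _ =
  subst (λ m → SelfIdentifying (C14 m) (code (suc m))) (sym (lemma a))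
        (locallyValid⇒selfIdentifying (m≤m+n 16 (a + a)) (code-locallyValid a))
  where
    lemma : ∀ a → 2 * (8 + a) ≡ 16 + (a + a)
    lemma = solve-∀
code-selfIdentifying 1 (s≤s ())
code-selfIdentifying 2 (s≤s (s≤s ()))
code-selfIdentifying 3 (s≤s (s≤s (s≤s ())))
code-selfIdentifying 4 (s≤s (s≤s (s≤s (s≤s ()))))
code-selfIdentifying 5 (s≤s (s≤s (s≤s (s≤s (s≤s ())))))

∣selfIdentifying∣≥k+2 : ∀ k → 5 < k → (C : Subset (suc (2 * k))) → SelfIdentifying (C14 (2 * k)) C → k + 2 ≤ ∣ C ∣
∣selfIdentifying∣≥k+2 k 5<k C sid = subst (k + 2 ≤_) (sym size) (Density.density b periodic valid k refl 12≤n)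
  where
    n = suc (2 * k)
    12≤n : 12 ≤ n
    12≤n = ≤-trans (*-monoʳ-≤ 2 5<k) (n≤1+n (2 * k))
    b : ℕ → Bool
    b i = codeBits C (4 + i)
    periodic : ∀ i → b (i + n) ≡ b i
    periodic i = trans (cong (codeBits C) (sym (+-assoc 4 i n))) (codeBits-periodic C (4 + i))
    valid = selfIdentifying⇒locallyValid (≤-trans (m≤m+n 8 4) (*-monoʳ-≤ 2 5<k)) sid
    size : ∣ C ∣ ≡ sumBelow n (λ i → bit (b i))
    size = begin
      ∣ C ∣                                          ≡⟨ ∣∣≡sumBelow C (codeBits C) (λ j → cong (lookup C) (sym (vertex-toℕ j))) ⟩
      sumBelow n (λ i → bit (codeBits C i))          ≡⟨ sumBelow-rotate n (bit ∘ codeBits C) (cong bit ∘ codeBits-periodic C) 4 ⟨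
      sumBelow n (λ i → bit (codeBits C (i + 4)))    ≡⟨ sumBelow-cong n (λ i → cong (bit ∘ codeBits C) (+-comm i 4)) ⟩
      sumBelow n (λ i → bit (b i))                   ∎
      where open ≡-Reasoning

theorem9 : (k : ℕ) → 5 < k → IsGammaSID (C14 (2 * k)) (k + 2)
theorem9 k 5<k =
  (code (suc (2 * k)) , code-selfIdentifying k 5<k , ∣code∣ k (≤-trans (m≤m+n 2 4) 5<k)) ,
  ∣selfIdentifying∣≥k+2 k 5<k
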